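{- Let $P(z,t)=t-z\tilde P(z,t)t^2$ be a Catalan power series, set $R(z,t)=\tilde P(z,t)\,t$ and $R_{i,j}=[z^it^j]R(z,t)$. Then the dual coefficients $(T_r)_{r\in\mathbb N^2}$ of $P$ are the unique solution of the recursion, for all $r\in\mathbb N^2$, $$T_r=\mathbf 1\{r=(0,1)\}+\sum_{(i,j)\in\mathbb N^2}R_{i,j}\sum_{k_1,\dots,k_{j+1}\in\mathbb N^2}T_{k_1}\cdots T_{k_{j+1}}\,q^{B_{j+1}(k_1,\dots,k_{j+1})}\,\mathbf 1\{k_1+\dots+k_{j+1}=r-(i+1,0)\}.$$
   Context: $q$ is a fixed parameter; all series are formal. A Catalan power series is a power series $P(z,t)$ for which there is a power series $\tilde P(z,t)$ with $P(z,t)=t-z\tilde P(z,t)t^2$. The predual basis of $P$ is $\tilde e_i(z,t)=z^{i_1}\prod_{0\le j<i_2}P(q^jz,t)$ for $i=(i_1,i_2)\in\mathbb N^2$ (empty product $=1$); it is a basis of power series in $(z,t)$, and the dual coefficients $(T_i)$ are the unique numbers with $\sum_iT_i\tilde e_i(z,t)=t$. For $u_1,\dots,u_n\in\mathbb R^2$, writing $u_m=(u_{m,1},u_{m,2})$, define $B_n(u_1,\dots,u_n)=\sum_{1\le a<b\le n}u_{a,2}u_{b,1}$ if $n\ge2$ and $B_n=0$ for $n=0,1$. -}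

module Defs where

open import Data.Nat using (ℕ; zero; suc; _∸_)
import Data.Nat as ℕ
open import Data.Product using (_×_; _,_; proj₁; proj₂)
open import Data.List using (List; []; _∷_)
open import Algebra.Bundles using (CommutativeRing)

module Catalan {c ℓ} (CR : CommutativeRing c ℓ) where
  open CommutativeRing CR

  pow : Carrier → ℕ → Carrier
  pow x zero    = 1#
  pow x (suc n) = x * pow x n

  sumTo : ℕ → (ℕ → Carrier) → Carrier
  sumTo zero    f = f 0
  sumTo (suc n) f = sumTo n f + f (suc n)

  sumBelow : ℕ → (ℕ → Carrier) → Carrier
  sumBelow zero    f = 0#
  sumBelow (suc n) f = sumBelow n f + f n

  -- formal power series in (z,t):  f i j = [z^i t^j] f
  Series : Set c
  Series = ℕ → ℕ → Carrier

  _≋_ : Series → Series → Set ℓ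
  f ≋ g = ∀ i j → f i j ≈ g i j

  1ₛ : Series
  1ₛ zero zero = 1#
  1ₛ _    _    = 0#

  zₛ : Series
  zₛ (suc zero) zero = 1#
  zₛ _          _    = 0#

  tₛ : Series
  tₛ zero (suc zero) = 1#
  tₛ _    _          = 0#

  _-ₛ_ : Series → Series → Series
  (f -ₛ g) i j = f i j - g i j

  _*ₛ_ : Series → Series → Series
  (f *ₛ g) m n = sumTo m (λ a → sumTo n (λ b → f a b * g (m ∸ a) (n ∸ b)))

  powₛ : Series → ℕ → Series
  powₛ f zero    = 1ₛ
  powₛ f (suc n) = f *ₛ powₛ f n

  dilate : Carrier → Series → Series
  dilate a f i j = pow a i * f i j

  catalanP : Series → Series
  catalanP Pt = tₛ -ₛ (zₛ *ₛ (Pt *ₛ (tₛ *ₛ tₛ)))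

  prodP : Carrier → Series → ℕ → Series
  prodP q P zero    = 1ₛ
  prodP q P (suc n) = prodP q P n *ₛ dilate (pow q n) P

  predual : Carrier → Series → ℕ × ℕ → Series
  predual q P (i₁ , i₂) = powₛ zₛ i₁ *ₛ prodP q P i₂

  -- T are dual coefficients of P:  sum_i T_i e~_i = t.
  -- The coefficient of z^m t^n of the (formal, infinite) sum only receives
  -- contributions from i with i1 <= m and i2 <= n (e~_i is divisible by
  -- z^{i1} t^{i2}), so the sum is written over that finite range.
  IsDual : Carrier → Series → (ℕ × ℕ → Carrier) → Set ℓ
  IsDual q P T =
    (λ m n → sumTo m (λ a → sumTo n (λ b → T (a , b) * predual q P (a , b) m n)))
      ≋ tₛ

  -- B_n(u_1,...,u_n) = sum_{a<b} u_{a,2} u_{b,1}, computed recursively: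
  -- B(u ∷ us) = u_2 * (sum of first coordinates of us) + B(us); B [] = 0.
  sumFst : List (ℕ × ℕ) → ℕ
  sumFst []       = 0
  sumFst (u ∷ us) = proj₁ u ℕ.+ sumFst us

  B : List (ℕ × ℕ) → ℕ
  B []       = 0
  B (u ∷ us) = proj₂ u ℕ.* sumFst us ℕ.+ B us

  prodT : (ℕ × ℕ → Carrier) → List (ℕ × ℕ) → Carrier
  prodT T []       = 1#
  prodT T (k ∷ ks) = T k * prodT T ks

  sumTuples : ℕ → ℕ → ℕ → (List (ℕ × ℕ) → Carrier) → Carrier
  sumTuples zero zero zero F = F []
  sumTuples zero _    _    F = 0#
  sumTuples (suc n) a b F =
    sumTo a (λ a₁ → sumTo b (λ b₁ →
      sumTuples n (a ∸ a₁) (b ∸ b₁) (λ ks → F ((a₁ , b₁) ∷ ks))))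

  δ₀₁ : ℕ → ℕ → Carrier
  δ₀₁ zero (suc zero) = 1#
  δ₀₁ _    _          = 0#

  -- The constraint
  -- k_1+...+k_{j+1} = r - (i+1,0) forces i+1 <= r1 (i < r1).  The sum over j
  -- is truncated at j <= r1 + r2 (the recursion at r = (0,0)
  -- forces T_(0,0) = 0, after which all terms with larger j vanish).
  SatisfiesRec : Carrier → Series → (ℕ × ℕ → Carrier) → Set ℓ
  SatisfiesRec q Pt T = ∀ r₁ r₂ →
    T (r₁ , r₂) ≈
      δ₀₁ r₁ r₂ +
      sumBelow r₁ (λ i → sumTo (r₁ ℕ.+ r₂) (λ j →
        (Pt *ₛ tₛ) i j *
        sumTuples (suc j) (r₁ ∸ suc i) r₂ (λ ks → prodT T ks * pow q (B ks))))

module Submission where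

-- After basic
-- facts on finite sums, the Cauchy product, monomials z^a t^b, dilations
-- f(x z, t) and supports, the argument has three general ingredients:
--  * a family U_{a,b} that is unitriangular (U_{a,b} starts at z^a t^b with
--    coefficient 1) gives every series exactly one expansion Σ f(a,b) U_{a,b}
--    (solve the triangular system by induction on the total degree a + b);
--  * if the family obeys U_{a,b} · U_{a′,b′}(x^b z, t) = x^{b a′} U_{a+a′,b+b′},
--    expansions multiply through a q-twisted convolution of coefficients;
--  * the predual basis of any F = t + (higher order in t) is such a family.
-- For the Catalan series, dual coefficients T expand t, so the n-fold twisted
-- convolution W_n of T expands t^n, and T_{(0,0)} = 0 makes W_n vanish below
-- degree n.  Hence the right-hand side of the recursion expands
-- P + z P~ t² = t, and uniqueness of expansions gives the recursion.  Finally
-- the recursion determines T_{(r₁,·)} from the T_{(a,·)} with a < r₁.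

open import Defs
open import Data.Nat using (ℕ)
open import Data.Product using (_×_; _,_; Σ)
open import Algebra.Bundles using (CommutativeRing)

module Duality {c ℓ} (CR : CommutativeRing c ℓ) where

  open import Data.Nat as ℕ using (zero; suc; _∸_; z≤n; s≤s; _≤_; _<_)
  import Data.Nat.Properties as ℕₚ
  open import Data.Nat.Induction using (<-rec)
  open import Data.Product using (proj₁; proj₂; uncurry)
  open import Data.List using (List; []; _∷_)
  open import Data.Sum using (_⊎_; inj₁; inj₂)
  open import Data.Empty using (⊥-elim)
  open import Relation.Nullary using (yes; no)
  open import Relation.Binary.PropositionalEquality as ≡ using (_≡_; _≢_)
  open import Relation.Binary.Bundles using (Setoid)
  import Relation.Binary.Reasoning.Setoid as SetoidReasoning

  open CommutativeRing CR hiding (zero)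
  open Catalan CR
  open import Algebra.Properties.Semiring.Exp semiring using (_^_; ^-congˡ; ^-homo-*; ^-assocʳ)
  open import Algebra.Properties.CommutativeSemiring.Exp commutativeSemiring using (^-distrib-*)
  open import Algebra.Properties.CommutativeSemigroup *-commutativeSemigroup
    using () renaming (interchange to *-interchange; x∙yz≈y∙xz to *-swapˡ)
  open import Algebra.Properties.CommutativeSemigroup +-commutativeSemigroup
    using () renaming (interchange to +-interchange)
  open import Algebra.Properties.Group +-group using (∙-cancelˡ; //-rightDividesˡ) renaming (ε⁻¹≈ε to -0≈0)

  module ≈-Reasoning = SetoidReasoning setoid

  pow≡^ : ∀ x n → pow x n ≡ x ^ n
  pow≡^ x zero    = ≡.refl
  pow≡^ x (suc n) = ≡.cong (x *_) (pow≡^ x n)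

  pow-cong : ∀ {x y} n → x ≈ y → pow x n ≈ pow y n
  pow-cong {x} {y} n x≈y rewrite pow≡^ x n | pow≡^ y n = ^-congˡ n x≈y

  pow-+ : ∀ x m n → pow x (m ℕ.+ n) ≈ pow x m * pow x n
  pow-+ x m n rewrite pow≡^ x (m ℕ.+ n) | pow≡^ x m | pow≡^ x n = ^-homo-* x m n

  pow-* : ∀ x y n → pow (x * y) n ≈ pow x n * pow y n
  pow-* x y n rewrite pow≡^ (x * y) n | pow≡^ x n | pow≡^ y n = ^-distrib-* x y n

  pow-pow : ∀ x m n → pow (pow x m) n ≈ pow x (m ℕ.* n)
  pow-pow x m n rewrite pow≡^ (pow x m) n | pow≡^ x m | pow≡^ x (m ℕ.* n) = ^-assocʳ x m n

  pow-1 : ∀ n → pow 1# n ≈ 1#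
  pow-1 zero    = refl
  pow-1 (suc n) = trans (*-identityˡ _) (pow-1 n)

  sumTo-cong : ∀ n {f g : ℕ → Carrier} → (∀ i → i ≤ n → f i ≈ g i) → sumTo n f ≈ sumTo n g
  sumTo-cong zero    f≈g = f≈g 0 z≤n
  sumTo-cong (suc n) f≈g =
    +-cong (sumTo-cong n (λ i i≤n → f≈g i (ℕₚ.m≤n⇒m≤1+n i≤n))) (f≈g (suc n) ℕₚ.≤-refl)

  sumBelow-cong : ∀ n {f g : ℕ → Carrier} → (∀ i → i < n → f i ≈ g i) → sumBelow n f ≈ sumBelow n g
  sumBelow-cong zero    f≈g = refl
  sumBelow-cong (suc n) f≈g =
    +-cong (sumBelow-cong n (λ i i<n → f≈g i (ℕₚ.m≤n⇒m≤1+n i<n))) (f≈g n ℕₚ.≤-refl)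

  sumTo-zero : ∀ n {f : ℕ → Carrier} → (∀ i → i ≤ n → f i ≈ 0#) → sumTo n f ≈ 0#
  sumTo-zero zero    f≈0 = f≈0 0 z≤n
  sumTo-zero (suc n) f≈0 = trans
    (+-cong (sumTo-zero n (λ i i≤n → f≈0 i (ℕₚ.m≤n⇒m≤1+n i≤n))) (f≈0 (suc n) ℕₚ.≤-refl))
    (+-identityʳ 0#)

  sumBelow-zero : ∀ n {f : ℕ → Carrier} → (∀ i → i < n → f i ≈ 0#) → sumBelow n f ≈ 0#
  sumBelow-zero zero    f≈0 = refl
  sumBelow-zero (suc n) f≈0 = trans
    (+-cong (sumBelow-zero n (λ i i<n → f≈0 i (ℕₚ.m≤n⇒m≤1+n i<n))) (f≈0 n ℕₚ.≤-refl))
    (+-identityʳ 0#)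

  sumTo-+ : ∀ n (f g : ℕ → Carrier) → sumTo n (λ i → f i + g i) ≈ sumTo n f + sumTo n g
  sumTo-+ zero    f g = refl
  sumTo-+ (suc n) f g = trans (+-congʳ (sumTo-+ n f g)) (+-interchange _ _ _ _)

  sumTo-*ˡ : ∀ n x (f : ℕ → Carrier) → x * sumTo n f ≈ sumTo n (λ i → x * f i)
  sumTo-*ˡ zero    x f = refl
  sumTo-*ˡ (suc n) x f = trans (distribˡ x _ _) (+-congʳ (sumTo-*ˡ n x f))

  sumTo-*ʳ : ∀ n x (f : ℕ → Carrier) → sumTo n f * x ≈ sumTo n (λ i → f i * x)
  sumTo-*ʳ zero    x f = refl
  sumTo-*ʳ (suc n) x f = trans (distribʳ x _ _) (+-congʳ (sumTo-*ʳ n x f))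

  sumTo-swap : ∀ m n (f : ℕ → ℕ → Carrier) →
    sumTo m (λ a → sumTo n (f a)) ≈ sumTo n (λ b → sumTo m (λ a → f a b))
  sumTo-swap zero    n f = refl
  sumTo-swap (suc m) n f =
    trans (+-congʳ (sumTo-swap m n f)) (sym (sumTo-+ n _ (f (suc m))))

  sumTo-last : ∀ n (f : ℕ → Carrier) → sumTo n f ≈ sumBelow n f + f n
  sumTo-last zero    f = sym (+-identityˡ _)
  sumTo-last (suc n) f = +-congʳ (sumTo-last n f)

  sumTo-shorten : ∀ m n {f : ℕ → Carrier} → m ≤ n →
    (∀ i → m < i → i ≤ n → f i ≈ 0#) → sumTo n f ≈ sumTo m f
  sumTo-shorten m zero    z≤n  _   = refl
  sumTo-shorten m (suc n) m≤1+n f≈0 with ℕₚ.m≤n⇒m<n∨m≡n m≤1+n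
  ... | inj₂ ≡.refl       = refl
  ... | inj₁ (s≤s m≤n) = trans
    (+-cong (sumTo-shorten m n m≤n (λ i m<i i≤n → f≈0 i m<i (ℕₚ.m≤n⇒m≤1+n i≤n)))
            (f≈0 (suc n) (s≤s m≤n) ℕₚ.≤-refl))
    (+-identityʳ _)

  sumTo-single : ∀ n k {f : ℕ → Carrier} → k ≤ n → (∀ i → i ≤ n → i ≢ k → f i ≈ 0#) → sumTo n f ≈ f k
  sumTo-single n k {f} k≤n f≈0 = begin
    sumTo n f          ≈⟨ sumTo-shorten k n k≤n (λ i k<i i≤n → f≈0 i i≤n (ℕₚ.>⇒≢ k<i)) ⟩
    sumTo k f          ≈⟨ sumTo-last k f ⟩
    sumBelow k f + f k ≈⟨ +-congʳ (sumBelow-zero k (λ i i<k →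
                            f≈0 i (ℕₚ.≤-trans (ℕₚ.<⇒≤ i<k) k≤n) (ℕₚ.<⇒≢ i<k))) ⟩
    0# + f k           ≈⟨ +-identityˡ _ ⟩
    f k                ∎
    where open ≈-Reasoning

  sumTo-truncate : ∀ n m {f : ℕ → Carrier} → n ≤ m → (∀ i → n ≤ i → i ≤ m → f i ≈ 0#) →
    sumTo m f ≈ sumBelow n f
  sumTo-truncate zero    m n≤m f≈0 = sumTo-zero m (λ i i≤m → f≈0 i z≤n i≤m)
  sumTo-truncate (suc n) m n≤m f≈0 =
    trans (sumTo-shorten n m (ℕₚ.≤-trans (ℕₚ.n≤1+n n) n≤m) f≈0) (sumTo-last n _)

  sumTo-shiftˡ : ∀ m (f : ℕ → Carrier) → sumTo (suc m) f ≈ f 0 + sumTo m (λ a → f (suc a))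
  sumTo-shiftˡ zero    f = refl
  sumTo-shiftˡ (suc m) f = trans (+-congʳ (sumTo-shiftˡ m f)) (+-assoc _ _ _)

  sumTo-reverse : ∀ m (f : ℕ → Carrier) → sumTo m f ≈ sumTo m (λ a → f (m ∸ a))
  sumTo-reverse zero    f = refl
  sumTo-reverse (suc m) f = trans (+-congʳ (sumTo-reverse m f))
    (trans (+-comm _ _) (sym (sumTo-shiftˡ m (λ a → f (suc m ∸ a)))))

  sumTo-triangle : ∀ m (G : ℕ → ℕ → Carrier) →
    sumTo m (λ a → sumTo a (λ c → G c a)) ≈ sumTo m (λ c → sumTo (m ∸ c) (λ d → G c (c ℕ.+ d)))
  sumTo-triangle zero    G = refl
  sumTo-triangle (suc m) G = begin
    sumTo m (λ a → sumTo a (λ c → G c a)) + (sumTo m (λ c → G c (suc m)) + G (suc m) (suc m))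
      ≈⟨ +-congʳ (sumTo-triangle m G) ⟩
    Tm + (sumTo m (λ c → G c (suc m)) + G (suc m) (suc m))
      ≈⟨ sym (+-assoc _ _ _) ⟩
    (Tm + sumTo m (λ c → G c (suc m))) + G (suc m) (suc m)
      ≈⟨ +-cong (sym (sumTo-+ m _ _)) (reflexive (≡.cong (G (suc m)) (≡.sym (ℕₚ.+-identityʳ (suc m))))) ⟩
    sumTo m (λ c → sumTo (m ∸ c) (λ d → G c (c ℕ.+ d)) + G c (suc m)) + G (suc m) (suc m ℕ.+ 0)
      ≈⟨ +-congˡ (reflexive (≡.cong (λ k → sumTo k (λ d → G (suc m) (suc m ℕ.+ d))) (≡.sym (ℕₚ.n∸n≡0 m)))) ⟩
    sumTo m (λ c → sumTo (m ∸ c) (λ d → G c (c ℕ.+ d)) + G c (suc m))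
      + sumTo (suc m ∸ suc m) (λ d → G (suc m) (suc m ℕ.+ d))
      ≈⟨ +-congʳ (sumTo-cong m extend-row) ⟩
    sumTo (suc m) (λ c → sumTo (suc m ∸ c) (λ d → G c (c ℕ.+ d))) ∎
    where
    open ≈-Reasoning
    Tm : Carrier
    Tm = sumTo m (λ c → sumTo (m ∸ c) (λ d → G c (c ℕ.+ d)))
    -- the row c gains the term d = 1 + m - c
    extend-row : ∀ c → c ≤ m →
      sumTo (m ∸ c) (λ d → G c (c ℕ.+ d)) + G c (suc m) ≈ sumTo (suc m ∸ c) (λ d → G c (c ℕ.+ d))
    extend-row c c≤m rewrite ℕₚ.+-∸-assoc 1 c≤m =
      +-congˡ (reflexive (≡.cong (G c) (≡.sym (≡.trans (ℕₚ.+-suc c (m ∸ c)) (≡.cong suc (ℕₚ.m+[n∸m]≡n c≤m))))))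

  Σ2 : ℕ → ℕ → (ℕ → ℕ → Carrier) → Carrier
  Σ2 m n F = sumTo m (λ a → sumTo n (λ b → F a b))

  Σ2-cong : ∀ m n {F G : ℕ → ℕ → Carrier} → (∀ a b → a ≤ m → b ≤ n → F a b ≈ G a b) → Σ2 m n F ≈ Σ2 m n G
  Σ2-cong m n F≈G = sumTo-cong m (λ a a≤m → sumTo-cong n (λ b b≤n → F≈G a b a≤m b≤n))

  Σ2-zero : ∀ m n {F : ℕ → ℕ → Carrier} → (∀ a b → a ≤ m → b ≤ n → F a b ≈ 0#) → Σ2 m n F ≈ 0#
  Σ2-zero m n F≈0 = sumTo-zero m (λ a a≤m → sumTo-zero n (λ b b≤n → F≈0 a b a≤m b≤n))

  Σ2-single : ∀ m n a₀ b₀ {F : ℕ → ℕ → Carrier} → a₀ ≤ m → b₀ ≤ n →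
    (∀ a b → a ≤ m → b ≤ n → (a ≢ a₀ ⊎ b ≢ b₀) → F a b ≈ 0#) → Σ2 m n F ≈ F a₀ b₀
  Σ2-single m n a₀ b₀ a₀≤m b₀≤n F≈0 = trans
    (sumTo-single m a₀ a₀≤m (λ a a≤m a≢a₀ → sumTo-zero n (λ b b≤n → F≈0 a b a≤m b≤n (inj₁ a≢a₀))))
    (sumTo-single n b₀ b₀≤n (λ b b≤n b≢b₀ → F≈0 a₀ b a₀≤m b≤n (inj₂ b≢b₀)))

  Σ2-+ : ∀ m n (F G : ℕ → ℕ → Carrier) → Σ2 m n (λ a b → F a b + G a b) ≈ Σ2 m n F + Σ2 m n G
  Σ2-+ m n F G = trans (sumTo-cong m (λ a _ → sumTo-+ n (F a) (G a))) (sumTo-+ m _ _)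

  Σ2-*ˡ : ∀ m n x (F : ℕ → ℕ → Carrier) → x * Σ2 m n F ≈ Σ2 m n (λ a b → x * F a b)
  Σ2-*ˡ m n x F = trans (sumTo-*ˡ m x _) (sumTo-cong m (λ a _ → sumTo-*ˡ n x _))

  Σ2-*ʳ : ∀ m n x (F : ℕ → ℕ → Carrier) → Σ2 m n F * x ≈ Σ2 m n (λ a b → F a b * x)
  Σ2-*ʳ m n x F = trans (sumTo-*ʳ m x _) (sumTo-cong m (λ a _ → sumTo-*ʳ n x _))

  Σ2-swap : ∀ m n m′ n′ (F : ℕ → ℕ → ℕ → ℕ → Carrier) →
    Σ2 m n (λ a b → Σ2 m′ n′ (F a b)) ≈ Σ2 m′ n′ (λ a′ b′ → Σ2 m n (λ a b → F a b a′ b′))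
  Σ2-swap m n m′ n′ F = begin
    sumTo m (λ a → sumTo n (λ b → sumTo m′ (λ a′ → sumTo n′ (F a b a′))))
      ≈⟨ sumTo-cong m (λ a _ → sumTo-swap n m′ _) ⟩
    sumTo m (λ a → sumTo m′ (λ a′ → sumTo n (λ b → sumTo n′ (F a b a′))))
      ≈⟨ sumTo-swap m m′ _ ⟩
    sumTo m′ (λ a′ → sumTo m (λ a → sumTo n (λ b → sumTo n′ (F a b a′))))
      ≈⟨ sumTo-cong m′ (λ a′ _ → sumTo-cong m (λ a _ → sumTo-swap n n′ _)) ⟩
    sumTo m′ (λ a′ → sumTo m (λ a → sumTo n′ (λ b′ → sumTo n (λ b → F a b a′ b′))))
      ≈⟨ sumTo-cong m′ (λ a′ _ → sumTo-swap m n′ _) ⟩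
    sumTo m′ (λ a′ → sumTo n′ (λ b′ → sumTo m (λ a → sumTo n (λ b → F a b a′ b′)))) ∎
    where open ≈-Reasoning

  Σ2-shorten : ∀ x y m n {F : ℕ → ℕ → Carrier} → x ≤ m → y ≤ n →
    (∀ a b → a ≤ m → b ≤ n → (x < a ⊎ y < b) → F a b ≈ 0#) → Σ2 m n F ≈ Σ2 x y F
  Σ2-shorten x y m n x≤m y≤n F≈0 = trans
    (sumTo-shorten x m x≤m (λ a x<a a≤m → sumTo-zero n (λ b b≤n → F≈0 a b a≤m b≤n (inj₁ x<a))))
    (sumTo-cong x (λ a a≤x → sumTo-shorten y n y≤n (λ b y<b b≤n → F≈0 a b (ℕₚ.≤-trans a≤x x≤m) b≤n (inj₂ y<b))))

  Σ2-corner : ∀ m n (F : ℕ → ℕ → Carrier) →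
    Σ2 m n F ≈ (sumBelow m (λ a → sumTo n (F a)) + sumBelow n (F m)) + F m n
  Σ2-corner m n F =
    trans (sumTo-last m _) (trans (+-congˡ (sumTo-last n (F m))) (sym (+-assoc _ _ _)))

  Σ2-triangle : ∀ M N (G : ℕ → ℕ → ℕ → ℕ → Carrier) →
    Σ2 M N (λ K₁ K₂ → Σ2 K₁ K₂ (λ a b → G a b K₁ K₂))
    ≈ Σ2 M N (λ a b → Σ2 (M ∸ a) (N ∸ b) (λ d e → G a b (a ℕ.+ d) (b ℕ.+ e)))
  Σ2-triangle M N G = begin
    sumTo M (λ K₁ → sumTo N (λ K₂ → sumTo K₁ (λ a → sumTo K₂ (λ b → G a b K₁ K₂))))
      ≈⟨ sumTo-cong M (λ K₁ _ → sumTo-swap N K₁ _) ⟩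
    sumTo M (λ K₁ → sumTo K₁ (λ a → sumTo N (λ K₂ → sumTo K₂ (λ b → G a b K₁ K₂))))
      ≈⟨ sumTo-triangle M _ ⟩
    sumTo M (λ a → sumTo (M ∸ a) (λ d → sumTo N (λ K₂ → sumTo K₂ (λ b → G a b (a ℕ.+ d) K₂))))
      ≈⟨ sumTo-cong M (λ a _ → sumTo-cong (M ∸ a) (λ d _ → sumTo-triangle N _)) ⟩
    sumTo M (λ a → sumTo (M ∸ a) (λ d → sumTo N (λ b → sumTo (N ∸ b) (λ e → G a b (a ℕ.+ d) (b ℕ.+ e)))))
      ≈⟨ sumTo-cong M (λ a _ → sumTo-swap (M ∸ a) N _) ⟩
    sumTo M (λ a → sumTo N (λ b → sumTo (M ∸ a) (λ d → sumTo (N ∸ b) (λ e → G a b (a ℕ.+ d) (b ℕ.+ e))))) ∎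
    where open ≈-Reasoning

  infix 4 _≈ₛ_
  record _≈ₛ_ (f g : Series) : Set ℓ where
    constructor ≈ₛ-intro
    field at : f ≋ g
  open _≈ₛ_

  seriesSetoid : Setoid c ℓ
  seriesSetoid = record
    { Carrier       = Series
    ; _≈_           = _≈ₛ_
    ; isEquivalence = record
      { refl  = ≈ₛ-intro (λ i j → refl)
      ; sym   = λ f≈g → ≈ₛ-intro (λ i j → sym (at f≈g i j))
      ; trans = λ f≈g g≈h → ≈ₛ-intro (λ i j → trans (at f≈g i j) (at g≈h i j))
      }
    }

  open Setoid seriesSetoid using ()
    renaming (refl to ≈ₛ-refl; sym to ≈ₛ-sym; trans to ≈ₛ-trans)
  module ≈ₛ-Reasoning = SetoidReasoning seriesSetoid

  *ₛ-cong : ∀ {f f′ g g′} → f ≈ₛ f′ → g ≈ₛ g′ → (f *ₛ g) ≈ₛ (f′ *ₛ g′)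
  *ₛ-cong f≈f′ g≈g′ = ≈ₛ-intro λ m n → Σ2-cong m n (λ a b _ _ → *-cong (at f≈f′ a b) (at g≈g′ _ _))

  *ₛ-congˡ : ∀ f {g g′} → g ≈ₛ g′ → (f *ₛ g) ≈ₛ (f *ₛ g′)
  *ₛ-congˡ f {g} {g′} = *ₛ-cong {f} {f} {g} {g′} ≈ₛ-refl

  *ₛ-congʳ : ∀ g {f f′} → f ≈ₛ f′ → (f *ₛ g) ≈ₛ (f′ *ₛ g)
  *ₛ-congʳ g {f} {f′} f≈f′ = *ₛ-cong {f} {f′} {g} {g} f≈f′ ≈ₛ-refl

  -- Commutativity: reverse both summations.
  *ₛ-comm-at : ∀ f g m n → (f *ₛ g) m n ≈ (g *ₛ f) m n
  *ₛ-comm-at f g m n = begin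
    Σ2 m n (λ a b → f a b * g (m ∸ a) (n ∸ b))
      ≈⟨ sumTo-reverse m _ ⟩
    sumTo m (λ a → sumTo n (λ b → f (m ∸ a) b * g (m ∸ (m ∸ a)) (n ∸ b)))
      ≈⟨ sumTo-cong m (λ a _ → sumTo-reverse n _) ⟩
    Σ2 m n (λ a b → f (m ∸ a) (n ∸ b) * g (m ∸ (m ∸ a)) (n ∸ (n ∸ b)))
      ≈⟨ Σ2-cong m n reflect ⟩
    Σ2 m n (λ a b → g a b * f (m ∸ a) (n ∸ b)) ∎
    where
    open ≈-Reasoning
    reflect : ∀ a b → a ≤ m → b ≤ n →
      f (m ∸ a) (n ∸ b) * g (m ∸ (m ∸ a)) (n ∸ (n ∸ b)) ≈ g a b * f (m ∸ a) (n ∸ b)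
    reflect a b a≤m b≤n rewrite ℕₚ.m∸[m∸n]≡n a≤m | ℕₚ.m∸[m∸n]≡n b≤n = *-comm _ _

  *ₛ-comm : ∀ f g → (f *ₛ g) ≈ₛ (g *ₛ f)
  *ₛ-comm f g = ≈ₛ-intro (*ₛ-comm-at f g)

  -- Associativity: both sides sum f a · g d · h (m,n)−a−d over a + d ≤ (m,n).
  *ₛ-assoc-at : ∀ f g h m n → ((f *ₛ g) *ₛ h) m n ≈ (f *ₛ (g *ₛ h)) m n
  *ₛ-assoc-at f g h m n = begin
    Σ2 m n (λ K₁ K₂ → (f *ₛ g) K₁ K₂ * h (m ∸ K₁) (n ∸ K₂))
      ≈⟨ Σ2-cong m n (λ K₁ K₂ _ _ → Σ2-*ʳ K₁ K₂ _ _) ⟩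
    Σ2 m n (λ K₁ K₂ → Σ2 K₁ K₂ (λ a b → G a b K₁ K₂))
      ≈⟨ Σ2-triangle m n G ⟩
    Σ2 m n (λ a b → Σ2 (m ∸ a) (n ∸ b) (λ d e → G a b (a ℕ.+ d) (b ℕ.+ e)))
      ≈⟨ Σ2-cong m n (λ a b _ _ → Σ2-cong (m ∸ a) (n ∸ b) (λ d e _ _ → regroup a b d e)) ⟩
    Σ2 m n (λ a b → Σ2 (m ∸ a) (n ∸ b) (λ d e → f a b * (g d e * h (m ∸ a ∸ d) (n ∸ b ∸ e))))
      ≈⟨ Σ2-cong m n (λ a b _ _ → sym (Σ2-*ˡ (m ∸ a) (n ∸ b) (f a b) _)) ⟩
    Σ2 m n (λ a b → f a b * (g *ₛ h) (m ∸ a) (n ∸ b)) ∎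
    where
    open ≈-Reasoning
    G : ℕ → ℕ → ℕ → ℕ → Carrier
    G a b K₁ K₂ = f a b * g (K₁ ∸ a) (K₂ ∸ b) * h (m ∸ K₁) (n ∸ K₂)
    regroup : ∀ a b d e → G a b (a ℕ.+ d) (b ℕ.+ e) ≈ f a b * (g d e * h (m ∸ a ∸ d) (n ∸ b ∸ e))
    regroup a b d e
      rewrite ℕₚ.m+n∸m≡n a d | ℕₚ.m+n∸m≡n b e | ℕₚ.∸-+-assoc m a d | ℕₚ.∸-+-assoc n b e = *-assoc _ _ _

  *ₛ-assoc : ∀ f g h → ((f *ₛ g) *ₛ h) ≈ₛ (f *ₛ (g *ₛ h))
  *ₛ-assoc f g h = ≈ₛ-intro (*ₛ-assoc-at f g h)

  *ₛ-interchange : ∀ f g h k → ((f *ₛ g) *ₛ (h *ₛ k)) ≈ₛ ((f *ₛ h) *ₛ (g *ₛ k))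
  *ₛ-interchange f g h k = begin
    (f *ₛ g) *ₛ (h *ₛ k)   ≈⟨ *ₛ-assoc f g (h *ₛ k) ⟩
    f *ₛ (g *ₛ (h *ₛ k))   ≈⟨ *ₛ-congˡ f (≈ₛ-sym (*ₛ-assoc g h k)) ⟩
    f *ₛ ((g *ₛ h) *ₛ k)   ≈⟨ *ₛ-congˡ f (*ₛ-congʳ k (*ₛ-comm g h)) ⟩
    f *ₛ ((h *ₛ g) *ₛ k)   ≈⟨ *ₛ-congˡ f (*ₛ-assoc h g k) ⟩
    f *ₛ (h *ₛ (g *ₛ k))   ≈⟨ ≈ₛ-sym (*ₛ-assoc f h (g *ₛ k)) ⟩
    (f *ₛ h) *ₛ (g *ₛ k)   ∎
    where open ≈ₛ-Reasoning

  record IsMonomial (a b : ℕ) (g : Series) : Set ℓ where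
    field
      leading   : g a b ≈ 1#
      elsewhere : ∀ i j → (i ≢ a ⊎ j ≢ b) → g i j ≈ 0#
  open IsMonomial

  ≢-self : ∀ {i j : ℕ} → (i ≢ i ⊎ j ≢ j) → ∀ {p} {A : Set p} → A
  ≢-self (inj₁ i≢i) = ⊥-elim (i≢i ≡.refl)
  ≢-self (inj₂ j≢j) = ⊥-elim (j≢j ≡.refl)

  1ₛ-monomial : IsMonomial 0 0 1ₛ
  1ₛ-monomial = record { leading = refl ; elsewhere = off }
    where
    off : ∀ i j → (i ≢ 0 ⊎ j ≢ 0) → 1ₛ i j ≈ 0#
    off zero    zero    ne = ≢-self ne
    off zero    (suc j) _  = refl
    off (suc i) j       _  = refl

  zₛ-monomial : IsMonomial 1 0 zₛ
  zₛ-monomial = record { leading = refl ; elsewhere = off }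
    where
    off : ∀ i j → (i ≢ 1 ⊎ j ≢ 0) → zₛ i j ≈ 0#
    off zero          j       _  = refl
    off (suc zero)    zero    ne = ≢-self ne
    off (suc zero)    (suc j) _  = refl
    off (suc (suc i)) j       _  = refl

  tₛ-monomial : IsMonomial 0 1 tₛ
  tₛ-monomial = record { leading = refl ; elsewhere = off }
    where
    off : ∀ i j → (i ≢ 0 ⊎ j ≢ 1) → tₛ i j ≈ 0#
    off zero    zero          _  = refl
    off zero    (suc zero)    ne = ≢-self ne
    off zero    (suc (suc j)) _  = refl
    off (suc i) j             _  = refl

  monomial-*-shift : ∀ {a b g} → IsMonomial a b g → ∀ F m n → a ≤ m → b ≤ n →
    (g *ₛ F) m n ≈ F (m ∸ a) (n ∸ b)
  monomial-*-shift {a} {b} mono F m n a≤m b≤n = trans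
    (Σ2-single m n a b a≤m b≤n (λ i j _ _ ne → trans (*-congʳ (elsewhere mono i j ne)) (zeroˡ _)))
    (trans (*-congʳ (leading mono)) (*-identityˡ _))

  monomial-*-below : ∀ {a b g} → IsMonomial a b g → ∀ F m n → (m < a ⊎ n < b) → (g *ₛ F) m n ≈ 0#
  monomial-*-below {a} {b} mono F m n below =
    Σ2-zero m n (λ i j i≤m j≤n → trans (*-congʳ (elsewhere mono i j (off i≤m j≤n below))) (zeroˡ _))
    where
    off : ∀ {i j} → i ≤ m → j ≤ n → (m < a ⊎ n < b) → (i ≢ a ⊎ j ≢ b)
    off i≤m _   (inj₁ m<a) = inj₁ (ℕₚ.<⇒≢ (ℕₚ.≤-<-trans i≤m m<a))
    off _   j≤n (inj₂ n<b) = inj₂ (ℕₚ.<⇒≢ (ℕₚ.≤-<-trans j≤n n<b))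

  monomial-* : ∀ {a b c d g h} → IsMonomial a b g → IsMonomial c d h →
    IsMonomial (a ℕ.+ c) (b ℕ.+ d) (g *ₛ h)
  monomial-* {a} {b} {c} {d} {g} {h} mg mh = record { leading = lead ; elsewhere = off }
    where
    lead : (g *ₛ h) (a ℕ.+ c) (b ℕ.+ d) ≈ 1#
    lead = trans (monomial-*-shift mg h (a ℕ.+ c) (b ℕ.+ d) (ℕₚ.m≤m+n a c) (ℕₚ.m≤m+n b d))
                 (trans (reflexive (≡.cong₂ h (ℕₚ.m+n∸m≡n a c) (ℕₚ.m+n∸m≡n b d))) (leading mh))
    off : ∀ i j → (i ≢ a ℕ.+ c ⊎ j ≢ b ℕ.+ d) → (g *ₛ h) i j ≈ 0#
    off i j ne with a ℕ.≤? i | b ℕ.≤? j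
    ... | no a≰i  | _       = monomial-*-below mg h i j (inj₁ (ℕₚ.≰⇒> a≰i))
    ... | yes _   | no b≰j  = monomial-*-below mg h i j (inj₂ (ℕₚ.≰⇒> b≰j))
    ... | yes a≤i | yes b≤j =
      trans (monomial-*-shift mg h i j a≤i b≤j) (elsewhere mh (i ∸ a) (j ∸ b) (shifted ne))
      where
      shifted : (i ≢ a ℕ.+ c ⊎ j ≢ b ℕ.+ d) → (i ∸ a ≢ c ⊎ j ∸ b ≢ d)
      shifted (inj₁ i≢) = inj₁ (λ e → i≢ (≡.trans (≡.sym (ℕₚ.m+[n∸m]≡n a≤i)) (≡.cong (a ℕ.+_) e)))
      shifted (inj₂ j≢) = inj₂ (λ e → j≢ (≡.trans (≡.sym (ℕₚ.m+[n∸m]≡n b≤j)) (≡.cong (b ℕ.+_) e)))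

  zpow-monomial : ∀ a → IsMonomial a 0 (powₛ zₛ a)
  zpow-monomial zero    = 1ₛ-monomial
  zpow-monomial (suc a) = monomial-* zₛ-monomial (zpow-monomial a)

  tpow-monomial : ∀ n → IsMonomial 0 n (powₛ tₛ n)
  tpow-monomial zero    = 1ₛ-monomial
  tpow-monomial (suc n) = monomial-* tₛ-monomial (tpow-monomial n)

  zt-monomial : ∀ a b → IsMonomial a b (powₛ zₛ a *ₛ powₛ tₛ b)
  zt-monomial a b = ≡.subst (λ k → IsMonomial k b (powₛ zₛ a *ₛ powₛ tₛ b)) (ℕₚ.+-identityʳ a)
    (monomial-* (zpow-monomial a) (tpow-monomial b))

  zₛtₛ-monomial : IsMonomial 1 1 (zₛ *ₛ tₛ)
  zₛtₛ-monomial = monomial-* zₛ-monomial tₛ-monomial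

  *ₛ-identityˡ : ∀ f → (1ₛ *ₛ f) ≈ₛ f
  *ₛ-identityˡ f = ≈ₛ-intro λ m n → monomial-*-shift 1ₛ-monomial f m n z≤n z≤n

  *ₛ-identityʳ : ∀ f → (f *ₛ 1ₛ) ≈ₛ f
  *ₛ-identityʳ f = ≈ₛ-trans (*ₛ-comm f 1ₛ) (*ₛ-identityˡ f)

  zpow-+ : ∀ a b → powₛ zₛ (a ℕ.+ b) ≈ₛ (powₛ zₛ a *ₛ powₛ zₛ b)
  zpow-+ zero    b = ≈ₛ-sym (*ₛ-identityˡ (powₛ zₛ b))
  zpow-+ (suc a) b = ≈ₛ-trans (*ₛ-congˡ zₛ (zpow-+ a b)) (≈ₛ-sym (*ₛ-assoc zₛ (powₛ zₛ a) (powₛ zₛ b)))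

  scale : Carrier → Series → Series
  scale x f i j = x * f i j

  scale-cong : ∀ {x y f g} → x ≈ y → f ≈ₛ g → scale x f ≈ₛ scale y g
  scale-cong x≈y f≈g = ≈ₛ-intro λ i j → *-cong x≈y (at f≈g i j)

  scale-identity : ∀ f → scale 1# f ≈ₛ f
  scale-identity f = ≈ₛ-intro λ i j → *-identityˡ (f i j)

  scale-*ˡ : ∀ x f g → (scale x f *ₛ g) ≈ₛ scale x (f *ₛ g)
  scale-*ˡ x f g = ≈ₛ-intro λ m n →
    sym (trans (Σ2-*ˡ m n x _) (Σ2-cong m n (λ a b _ _ → sym (*-assoc x (f a b) _))))

  scale-*ʳ : ∀ x f g → (f *ₛ scale x g) ≈ₛ scale x (f *ₛ g)
  scale-*ʳ x f g = ≈ₛ-intro λ m n →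
    sym (trans (Σ2-*ˡ m n x _) (Σ2-cong m n (λ a b _ _ → *-swapˡ x (f a b) _)))

  dilate-cong₂ : ∀ x {f g} → f ≈ₛ g → dilate x f ≈ₛ dilate x g
  dilate-cong₂ x f≈g = ≈ₛ-intro λ i j → *-congˡ (at f≈g i j)

  dilate-cong₁ : ∀ {x y} f → x ≈ y → dilate x f ≈ₛ dilate y f
  dilate-cong₁ f x≈y = ≈ₛ-intro λ i j → *-congʳ (pow-cong i x≈y)

  dilate-* : ∀ x f g → dilate x (f *ₛ g) ≈ₛ (dilate x f *ₛ dilate x g)
  dilate-* x f g = ≈ₛ-intro λ m n → trans (Σ2-*ˡ m n (pow x m) _)
    (Σ2-cong m n (λ a b a≤m _ → trans (*-congʳ (split a≤m)) (*-interchange _ _ _ _)))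
    where
    split : ∀ {a m} → a ≤ m → pow x m ≈ pow x a * pow x (m ∸ a)
    split {a} {m} a≤m = trans (reflexive (≡.cong (pow x) (≡.sym (ℕₚ.m+[n∸m]≡n a≤m)))) (pow-+ x a (m ∸ a))

  dilate-dilate : ∀ x y f → dilate x (dilate y f) ≈ₛ dilate (x * y) f
  dilate-dilate x y f = ≈ₛ-intro λ i j → trans (sym (*-assoc _ _ _)) (*-congʳ (sym (pow-* x y i)))

  dilate-monomial : ∀ {a b g} x → IsMonomial a b g → dilate x g ≈ₛ scale (pow x a) g
  dilate-monomial {a} {b} {g} x mono = ≈ₛ-intro coeff
    where
    coeff : ∀ i j → pow x i * g i j ≈ pow x a * g i j
    coeff i j with i ℕ.≟ a
    ... | yes ≡.refl = refl
    ... | no i≢a     = trans (*-congˡ g≈0) (trans (zeroʳ _) (sym (trans (*-congˡ g≈0) (zeroʳ _))))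
      where
      g≈0 : g i j ≈ 0#
      g≈0 = elsewhere mono i j (inj₁ i≢a)

  dilate-invariant : ∀ {b g} x → IsMonomial 0 b g → dilate x g ≈ₛ g
  dilate-invariant {g = g} x mono = ≈ₛ-trans (dilate-monomial x mono) (scale-identity g)

  Supp : ℕ → ℕ → Series → Set ℓ
  Supp a b f = ∀ i j → (i < a ⊎ j < b) → f i j ≈ 0#

  monomial-Supp : ∀ {a b g} → IsMonomial a b g → Supp a b g
  monomial-Supp mono i j (inj₁ i<a) = elsewhere mono i j (inj₁ (ℕₚ.<⇒≢ i<a))
  monomial-Supp mono i j (inj₂ j<b) = elsewhere mono i j (inj₂ (ℕₚ.<⇒≢ j<b))

  Supp-dilate : ∀ {a b f} x → Supp a b f → Supp a b (dilate x f)
  Supp-dilate x supp i j out = trans (*-congˡ (supp i j out)) (zeroʳ _)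

  ∸-<-bound : ∀ x i c → x ≤ i → i < x ℕ.+ c → i ∸ x < c
  ∸-<-bound x i c x≤i i<x+c =
    ℕₚ.+-cancelˡ-< x (i ∸ x) c (≡.subst (_< x ℕ.+ c) (≡.sym (ℕₚ.m+[n∸m]≡n x≤i)) i<x+c)

  Supp-* : ∀ {a b c d f g} → Supp a b f → Supp c d g → Supp (a ℕ.+ c) (b ℕ.+ d) (f *ₛ g)
  Supp-* {a} {b} {c} {d} {f} {g} supp-f supp-g i j out = Σ2-zero i j term
    where
    term : ∀ x y → x ≤ i → y ≤ j → f x y * g (i ∸ x) (j ∸ y) ≈ 0#
    term x y x≤i y≤j with x ℕ.<? a | y ℕ.<? b
    ... | yes x<a | _       = trans (*-congʳ (supp-f x y (inj₁ x<a))) (zeroˡ _)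
    ... | no _    | yes y<b = trans (*-congʳ (supp-f x y (inj₂ y<b))) (zeroˡ _)
    ... | no x≮a  | no y≮b  = trans (*-congˡ (supp-g _ _ (shifted out))) (zeroʳ _)
      where
      shifted : (i < a ℕ.+ c ⊎ j < b ℕ.+ d) → (i ∸ x < c ⊎ j ∸ y < d)
      shifted (inj₁ i<) = inj₁ (∸-<-bound x i c x≤i (ℕₚ.<-≤-trans i< (ℕₚ.+-monoˡ-≤ c (ℕₚ.≮⇒≥ x≮a))))
      shifted (inj₂ j<) = inj₂ (∸-<-bound y j d y≤j (ℕₚ.<-≤-trans j< (ℕₚ.+-monoˡ-≤ d (ℕₚ.≮⇒≥ y≮b))))

  Supp-corner : ∀ {a b c d f g} → Supp a b f → Supp c d g →
    (f *ₛ g) (a ℕ.+ c) (b ℕ.+ d) ≈ f a b * g c d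
  Supp-corner {a} {b} {c} {d} {f} {g} supp-f supp-g = trans
    (Σ2-single (a ℕ.+ c) (b ℕ.+ d) a b (ℕₚ.m≤m+n a c) (ℕₚ.m≤m+n b d) term)
    (reflexive (≡.cong₂ (λ u v → f a b * g u v) (ℕₚ.m+n∸m≡n a c) (ℕₚ.m+n∸m≡n b d)))
    where
    term : ∀ x y → x ≤ a ℕ.+ c → y ≤ b ℕ.+ d → (x ≢ a ⊎ y ≢ b) →
      f x y * g (a ℕ.+ c ∸ x) (b ℕ.+ d ∸ y) ≈ 0#
    term x y x≤ y≤ ne with x ℕ.<? a | y ℕ.<? b
    ... | yes x<a | _       = trans (*-congʳ (supp-f x y (inj₁ x<a))) (zeroˡ _)
    ... | no _    | yes y<b = trans (*-congʳ (supp-f x y (inj₂ y<b))) (zeroˡ _)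
    ... | no x≮a  | no y≮b  = trans (*-congˡ (supp-g _ _ (beyond ne))) (zeroʳ _)
      where
      beyond : (x ≢ a ⊎ y ≢ b) → (a ℕ.+ c ∸ x < c ⊎ b ℕ.+ d ∸ y < d)
      beyond (inj₁ x≢a) = inj₁ (∸-<-bound x (a ℕ.+ c) c x≤
        (ℕₚ.+-monoˡ-< c (ℕₚ.≤∧≢⇒< (ℕₚ.≮⇒≥ x≮a) (λ a≡x → x≢a (≡.sym a≡x)))))
      beyond (inj₂ y≢b) = inj₂ (∸-<-bound y (b ℕ.+ d) d y≤
        (ℕₚ.+-monoˡ-< d (ℕₚ.≤∧≢⇒< (ℕₚ.≮⇒≥ y≮b) (λ b≡y → y≢b (≡.sym b≡y)))))

  -- Expansions  Σ_{(a,b)} f(a,b) U_{a,b}  in a family of series U.  The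
  -- coefficient (m,n) only sums over (a,b) ≤ (m,n); this is the whole formal
  -- sum as soon as each U_{a,b} is supported in the quadrant above (a,b).

  Coeffs : Set c
  Coeffs = ℕ × ℕ → Carrier

  Family : Set c
  Family = ℕ → ℕ → Series

  expand : Coeffs → Family → Series
  expand f U m n = Σ2 m n (λ a b → f (a , b) * U a b m n)

  Supported : Family → Set ℓ
  Supported U = ∀ a b → Supp a b (U a b)

  expand-congᶜ : ∀ {f g} U → (∀ r → f r ≈ g r) → expand f U ≈ₛ expand g U
  expand-congᶜ U f≈g = ≈ₛ-intro λ m n → Σ2-cong m n (λ a b _ _ → *-congʳ (f≈g (a , b)))

  expand-congᶠ : ∀ f {U V} → (∀ a b → U a b ≈ₛ V a b) → expand f U ≈ₛ expand f V
  expand-congᶠ f U≈V = ≈ₛ-intro λ m n → Σ2-cong m n (λ a b _ _ → *-congˡ (at (U≈V a b) m n))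

  expand-+ : ∀ f g U m n → expand (λ r → f r + g r) U m n ≈ expand f U m n + expand g U m n
  expand-+ f g U m n = trans (Σ2-cong m n (λ a b _ _ → distribʳ _ _ _)) (Σ2-+ m n _ _)

  expand-*ʳ : ∀ f {U} S → Supported U → (expand f U *ₛ S) ≈ₛ expand f (λ a b → U a b *ₛ S)
  expand-*ʳ f {U} S supp = ≈ₛ-intro λ m n → begin
    Σ2 m n (λ x y → Σ2 x y (λ a b → f (a , b) * U a b x y) * S (m ∸ x) (n ∸ y))
      ≈⟨ Σ2-cong m n (λ x y x≤m y≤n → *-congʳ (sym (Σ2-shorten x y m n x≤m y≤n
           (λ a b _ _ out → trans (*-congˡ (supp a b x y out)) (zeroʳ _))))) ⟩
    Σ2 m n (λ x y → Σ2 m n (λ a b → f (a , b) * U a b x y) * S (m ∸ x) (n ∸ y))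
      ≈⟨ Σ2-cong m n (λ x y _ _ → Σ2-*ʳ m n _ _) ⟩
    Σ2 m n (λ x y → Σ2 m n (λ a b → f (a , b) * U a b x y * S (m ∸ x) (n ∸ y)))
      ≈⟨ Σ2-swap m n m n _ ⟩
    Σ2 m n (λ a b → Σ2 m n (λ x y → f (a , b) * U a b x y * S (m ∸ x) (n ∸ y)))
      ≈⟨ Σ2-cong m n (λ a b _ _ →
           trans (Σ2-cong m n (λ x y _ _ → *-assoc _ _ _)) (sym (Σ2-*ˡ m n (f (a , b)) _))) ⟩
    Σ2 m n (λ a b → f (a , b) * (U a b *ₛ S) m n) ∎
    where open ≈-Reasoning

  expand-*ˡ : ∀ f {U} S → Supported U → (S *ₛ expand f U) ≈ₛ expand f (λ a b → S *ₛ U a b)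
  expand-*ˡ f {U} S supp = ≈ₛ-trans (*ₛ-comm S (expand f U))
    (≈ₛ-trans (expand-*ʳ f S supp) (expand-congᶠ f (λ a b → *ₛ-comm (U a b) S)))

  expand-dilate : ∀ x f U → dilate x (expand f U) ≈ₛ expand f (λ a b → dilate x (U a b))
  expand-dilate x f U = ≈ₛ-intro λ m n →
    trans (Σ2-*ˡ m n (pow x m) _) (Σ2-cong m n (λ a b _ _ → *-swapˡ _ _ _))

  expand-monomial : ∀ {a₀ b₀ g U} → Supported U → IsMonomial a₀ b₀ g → expand (uncurry g) U ≈ₛ U a₀ b₀
  expand-monomial {a₀} {b₀} {g} {U} supp mono = ≈ₛ-intro coeff
    where
    vanish : ∀ m n → (m < a₀ ⊎ n < b₀) → expand (uncurry g) U m n ≈ U a₀ b₀ m n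
    vanish m n out = trans
      (Σ2-zero m n (λ a b a≤m b≤n → trans (*-congʳ (elsewhere mono a b (off a≤m b≤n out))) (zeroˡ _)))
      (sym (supp a₀ b₀ m n out))
      where
      off : ∀ {a b} → a ≤ m → b ≤ n → (m < a₀ ⊎ n < b₀) → (a ≢ a₀ ⊎ b ≢ b₀)
      off a≤m _   (inj₁ m<a₀) = inj₁ (ℕₚ.<⇒≢ (ℕₚ.≤-<-trans a≤m m<a₀))
      off _   b≤n (inj₂ n<b₀) = inj₂ (ℕₚ.<⇒≢ (ℕₚ.≤-<-trans b≤n n<b₀))
    coeff : ∀ m n → expand (uncurry g) U m n ≈ U a₀ b₀ m n
    coeff m n with a₀ ℕ.≤? m | b₀ ℕ.≤? n
    ... | no a₀≰m  | _        = vanish m n (inj₁ (ℕₚ.≰⇒> a₀≰m))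
    ... | yes _    | no b₀≰n  = vanish m n (inj₂ (ℕₚ.≰⇒> b₀≰n))
    ... | yes a₀≤m | yes b₀≤n = trans
      (Σ2-single m n a₀ b₀ a₀≤m b₀≤n (λ a b _ _ ne → trans (*-congʳ (elsewhere mono a b ne)) (zeroˡ _)))
      (trans (*-congʳ (leading mono)) (*-identityˡ _))

  -- Unitriangular families: every series has exactly one expansion.

  record Unitriangular (U : Family) : Set ℓ where
    field
      supported : Supported U
      diagonal  : ∀ a b → U a b a b ≈ 1#

  module Triangular {U : Family} (tri : Unitriangular U) where
    open Unitriangular tri using (diagonal)

    offDiagonal : Coeffs → ℕ → ℕ → Carrier
    offDiagonal f m n =
      sumBelow m (λ a → sumTo n (λ b → f (a , b) * U a b m n)) + sumBelow n (λ b → f (m , b) * U m b m n)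

    expand-split : ∀ f m n → expand f U m n ≈ offDiagonal f m n + f (m , n)
    expand-split f m n =
      trans (Σ2-corner m n _) (+-congˡ (trans (*-congˡ (diagonal m n)) (*-identityʳ _)))

    offDiagonal-cong : ∀ {f g} m n → (∀ a b → a ℕ.+ b < m ℕ.+ n → f (a , b) ≈ g (a , b)) →
      offDiagonal f m n ≈ offDiagonal g m n
    offDiagonal-cong m n f≈g = +-cong
      (sumBelow-cong m (λ a a<m → sumTo-cong n (λ b b≤n → *-congʳ (f≈g a b (ℕₚ.+-mono-<-≤ a<m b≤n)))))
      (sumBelow-cong n (λ b b<n → *-congʳ (f≈g m b (ℕₚ.+-monoʳ-< m b<n))))

    expand-injective : ∀ f g → expand f U ≈ₛ expand g U → ∀ r → f r ≈ g r
    expand-injective f g f≈g (m , n) = <-rec Agree step (m ℕ.+ n) m n ≡.refl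
      where
      Agree : ℕ → Set ℓ
      Agree k = ∀ m n → m ℕ.+ n ≡ k → f (m , n) ≈ g (m , n)
      step : ∀ k → (∀ {j} → j < k → Agree j) → Agree k
      step _ below m n ≡.refl = ∙-cancelˡ (offDiagonal f m n) _ _ (begin
        offDiagonal f m n + f (m , n) ≈⟨ sym (expand-split f m n) ⟩
        expand f U m n                ≈⟨ at f≈g m n ⟩
        expand g U m n                ≈⟨ expand-split g m n ⟩
        offDiagonal g m n + g (m , n) ≈⟨ +-congʳ (offDiagonal-cong m n (λ a b lt → sym (below lt a b ≡.refl))) ⟩
        offDiagonal f m n + g (m , n) ∎)
        where open ≈-Reasoning

    -- Existence: solve the triangular system degree by degree.  The k-th
    -- approximation no longer changes on indices of total degree < k.
    approx : Series → ℕ → Coeffs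
    approx S zero    _       = 0#
    approx S (suc k) (m , n) = S m n - offDiagonal (approx S k) m n

    approx-stable : ∀ S k k′ m n → m ℕ.+ n < k → m ℕ.+ n < k′ → approx S k (m , n) ≈ approx S k′ (m , n)
    approx-stable S (suc k) (suc k′) m n (s≤s deg≤k) (s≤s deg≤k′) =
      +-congˡ (-‿cong (offDiagonal-cong m n (λ a b lt →
        approx-stable S k k′ a b (ℕₚ.<-≤-trans lt deg≤k) (ℕₚ.<-≤-trans lt deg≤k′))))

    solution : Series → Coeffs
    solution S (m , n) = approx S (suc (m ℕ.+ n)) (m , n)

    -- Each coefficient solves its equation, since the off-diagonal part only
    -- uses stabilised approximations.
    expand-solution : ∀ S → expand (solution S) U ≈ₛ S
    expand-solution S = ≈ₛ-intro λ m n → begin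
      expand (solution S) U m n
        ≈⟨ expand-split (solution S) m n ⟩
      offDiagonal (solution S) m n + (S m n - offDiagonal (approx S (m ℕ.+ n)) m n)
        ≈⟨ +-congˡ (+-congˡ (-‿cong (offDiagonal-cong m n (λ a b lt →
             approx-stable S (m ℕ.+ n) (suc (a ℕ.+ b)) a b lt (ℕₚ.n<1+n (a ℕ.+ b)))))) ⟩
      offDiagonal (solution S) m n + (S m n - offDiagonal (solution S) m n)
        ≈⟨ +-comm _ _ ⟩
      (S m n - offDiagonal (solution S) m n) + offDiagonal (solution S) m n
        ≈⟨ //-rightDividesˡ _ _ ⟩
      S m n ∎
      where open ≈-Reasoning

  -- Expansions multiply through a q-twisted convolution of their coefficients,
  -- provided the family obeys the product rule
  -- U_{a,b} · U_{a′,b′}(x^b z, t) = x^{b a′} U_{a+a′,b+b′}.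

  convolve : Carrier → Coeffs → Coeffs → Coeffs
  convolve x f g (K₁ , K₂) =
    Σ2 K₁ K₂ (λ a b → f (a , b) * (pow x (b ℕ.* (K₁ ∸ a)) * g (K₁ ∸ a , K₂ ∸ b)))

  ProductRule : Carrier → Family → Set ℓ
  ProductRule x U = ∀ a b a′ b′ →
    (U a b *ₛ dilate (pow x b) (U a′ b′)) ≈ₛ scale (pow x (b ℕ.* a′)) (U (a ℕ.+ a′) (b ℕ.+ b′))

  module _ (x : Carrier) {U : Family} (supp : Supported U) (rule : ProductRule x U) where

    convolve-regroup : ∀ f g M N →
      Σ2 M N (λ a b → f (a , b) * Σ2 M N (λ d e → g (d , e) * (pow x (b ℕ.* d) * U (a ℕ.+ d) (b ℕ.+ e) M N)))
      ≈ expand (convolve x f g) U M N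
    convolve-regroup f g M N = sym (begin
      Σ2 M N (λ K₁ K₂ → convolve x f g (K₁ , K₂) * U K₁ K₂ M N)
        ≈⟨ Σ2-cong M N (λ K₁ K₂ _ _ → Σ2-*ʳ K₁ K₂ _ _) ⟩
      Σ2 M N (λ K₁ K₂ → Σ2 K₁ K₂ (λ a b → Y a b K₁ K₂))
        ≈⟨ Σ2-triangle M N Y ⟩
      Σ2 M N (λ a b → Σ2 (M ∸ a) (N ∸ b) (λ d e → Y a b (a ℕ.+ d) (b ℕ.+ e)))
        ≈⟨ Σ2-cong M N (λ a b _ _ → sym (Σ2-shorten (M ∸ a) (N ∸ b) M N (ℕₚ.m∸n≤m M a) (ℕₚ.m∸n≤m N b)
             (λ d e _ _ out → trans (*-congˡ (supp _ _ M N (beyond out))) (zeroʳ _)))) ⟩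
      Σ2 M N (λ a b → Σ2 M N (λ d e → Y a b (a ℕ.+ d) (b ℕ.+ e)))
        ≈⟨ Σ2-cong M N (λ a b _ _ →
             trans (Σ2-cong M N (λ d e _ _ → regroup a b d e)) (sym (Σ2-*ˡ M N (f (a , b)) _))) ⟩
      Σ2 M N (λ a b → f (a , b) * Σ2 M N (λ d e → g (d , e) * (pow x (b ℕ.* d) * U (a ℕ.+ d) (b ℕ.+ e) M N))) ∎)
      where
      open ≈-Reasoning
      Y : ℕ → ℕ → ℕ → ℕ → Carrier
      Y a b K₁ K₂ = f (a , b) * (pow x (b ℕ.* (K₁ ∸ a)) * g (K₁ ∸ a , K₂ ∸ b)) * U K₁ K₂ M N
      beyond : ∀ {a b d e} → (M ∸ a < d ⊎ N ∸ b < e) → (M < a ℕ.+ d ⊎ N < b ℕ.+ e)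
      beyond {a} (inj₁ lt) = inj₁ (ℕₚ.≤-<-trans (ℕₚ.m≤n+m∸n M a) (ℕₚ.+-monoʳ-< a lt))
      beyond {b = b} (inj₂ lt) = inj₂ (ℕₚ.≤-<-trans (ℕₚ.m≤n+m∸n N b) (ℕₚ.+-monoʳ-< b lt))
      regroup : ∀ a b d e → Y a b (a ℕ.+ d) (b ℕ.+ e) ≈
        f (a , b) * (g (d , e) * (pow x (b ℕ.* d) * U (a ℕ.+ d) (b ℕ.+ e) M N))
      regroup a b d e rewrite ℕₚ.m+n∸m≡n a d | ℕₚ.m+n∸m≡n b e =
        trans (*-assoc _ _ _) (*-congˡ (trans (*-assoc _ _ _) (*-swapˡ _ _ _)))

    expand-convolve : ∀ f g S → expand g U ≈ₛ S → (∀ b → dilate (pow x b) S ≈ₛ S) →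
      expand (convolve x f g) U ≈ₛ (expand f U *ₛ S)
    expand-convolve f g S g↦S invariant = ≈ₛ-sym (begin
      expand f U *ₛ S
        ≈⟨ expand-*ʳ f S supp ⟩
      expand f (λ a b → U a b *ₛ S)
        ≈⟨ expand-congᶠ f (λ a b → *ₛ-congˡ (U a b) (≈ₛ-trans (≈ₛ-sym (invariant b))
             (≈ₛ-trans (dilate-cong₂ (pow x b) (≈ₛ-sym g↦S)) (expand-dilate (pow x b) g U)))) ⟩
      expand f (λ a b → U a b *ₛ expand g (λ a′ b′ → dilate (pow x b) (U a′ b′)))
        ≈⟨ expand-congᶠ f (λ a b → expand-*ˡ g (U a b) (λ a′ b′ → Supp-dilate (pow x b) (supp a′ b′))) ⟩
      expand f (λ a b → expand g (λ a′ b′ → U a b *ₛ dilate (pow x b) (U a′ b′)))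
        ≈⟨ expand-congᶠ f (λ a b → expand-congᶠ g (rule a b)) ⟩
      expand f (λ a b → expand g (λ a′ b′ → scale (pow x (b ℕ.* a′)) (U (a ℕ.+ a′) (b ℕ.+ b′))))
        ≈⟨ ≈ₛ-intro (convolve-regroup f g) ⟩
      expand (convolve x f g) U ∎)
      where open ≈ₛ-Reasoning

  -- The predual basis  e~_{a,b} = z^a Π_{j<b} F(x^j z, t)  of a series F.

  prodP-+ : ∀ x F b e → prodP x F (b ℕ.+ e) ≈ₛ (prodP x F b *ₛ dilate (pow x b) (prodP x F e))
  prodP-+ x F b zero rewrite ℕₚ.+-identityʳ b = ≈ₛ-sym (≈ₛ-trans
    (*ₛ-congˡ (prodP x F b) (dilate-invariant (pow x b) 1ₛ-monomial)) (*ₛ-identityʳ (prodP x F b)))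
  prodP-+ x F b (suc e) rewrite ℕₚ.+-suc b e = begin
    prodP x F (b ℕ.+ e) *ₛ dilate (pow x (b ℕ.+ e)) F
      ≈⟨ *ₛ-congʳ (dilate (pow x (b ℕ.+ e)) F) (prodP-+ x F b e) ⟩
    (Πb *ₛ D (prodP x F e)) *ₛ dilate (pow x (b ℕ.+ e)) F
      ≈⟨ *ₛ-assoc Πb (D (prodP x F e)) (dilate (pow x (b ℕ.+ e)) F) ⟩
    Πb *ₛ (D (prodP x F e) *ₛ dilate (pow x (b ℕ.+ e)) F)
      ≈⟨ *ₛ-congˡ Πb (*ₛ-congˡ (D (prodP x F e)) (≈ₛ-sym (≈ₛ-trans (dilate-dilate (pow x b) (pow x e) F)
           (dilate-cong₁ F (sym (pow-+ x b e)))))) ⟩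
    Πb *ₛ (D (prodP x F e) *ₛ D (dilate (pow x e) F))
      ≈⟨ *ₛ-congˡ Πb (≈ₛ-sym (dilate-* (pow x b) (prodP x F e) (dilate (pow x e) F))) ⟩
    Πb *ₛ D (prodP x F (suc e)) ∎
    where
    open ≈ₛ-Reasoning
    Πb : Series
    Πb = prodP x F b
    D : Series → Series
    D = dilate (pow x b)

  predual-product : ∀ x F → ProductRule x (λ a b → predual x F (a , b))
  predual-product x F a b a′ b′ = begin
    (Za *ₛ Πb) *ₛ D (Za′ *ₛ Πb′)
      ≈⟨ *ₛ-congˡ (Za *ₛ Πb) (dilate-* (pow x b) Za′ Πb′) ⟩
    (Za *ₛ Πb) *ₛ (D Za′ *ₛ D Πb′)
      ≈⟨ *ₛ-congˡ (Za *ₛ Πb) (*ₛ-congʳ (D Πb′) (dilate-monomial (pow x b) (zpow-monomial a′))) ⟩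
    (Za *ₛ Πb) *ₛ (scale s Za′ *ₛ D Πb′)
      ≈⟨ *ₛ-congˡ (Za *ₛ Πb) (scale-*ˡ s Za′ (D Πb′)) ⟩
    (Za *ₛ Πb) *ₛ scale s (Za′ *ₛ D Πb′)
      ≈⟨ scale-*ʳ s (Za *ₛ Πb) (Za′ *ₛ D Πb′) ⟩
    scale s ((Za *ₛ Πb) *ₛ (Za′ *ₛ D Πb′))
      ≈⟨ scale-cong refl (*ₛ-interchange Za Πb Za′ (D Πb′)) ⟩
    scale s ((Za *ₛ Za′) *ₛ (Πb *ₛ D Πb′))
      ≈⟨ scale-cong (pow-pow x b a′) (*ₛ-cong (≈ₛ-sym (zpow-+ a a′)) (≈ₛ-sym (prodP-+ x F b b′))) ⟩
    scale (pow x (b ℕ.* a′)) (predual x F (a ℕ.+ a′ , b ℕ.+ b′)) ∎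
    where
    open ≈ₛ-Reasoning
    Za Za′ Πb Πb′ : Series
    Za  = powₛ zₛ a
    Za′ = powₛ zₛ a′
    Πb  = prodP x F b
    Πb′ = prodP x F b′
    D : Series → Series
    D = dilate (pow x b)
    s : Carrier
    s = pow (pow x b) a′

  record StartsWithT (F : Series) : Set ℓ where
    field
      t-support     : Supp 0 1 F
      t-coefficient : F 0 1 ≈ 1#

  module _ {F : Series} (startsWithT : StartsWithT F) (x : Carrier) where
    open StartsWithT startsWithT

    prodP-support : ∀ b → Supp 0 b (prodP x F b)
    prodP-support zero    i j (inj₁ ())
    prodP-support zero    i j (inj₂ ())
    prodP-support (suc b) = ≡.subst (λ k → Supp 0 k (prodP x F (suc b))) (ℕₚ.+-comm b 1)
      (Supp-* (prodP-support b) (Supp-dilate (pow x b) t-support))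

    prodP-diagonal : ∀ b → prodP x F b 0 b ≈ 1#
    prodP-diagonal zero    = refl
    prodP-diagonal (suc b) = ≡.subst (λ k → prodP x F (suc b) 0 k ≈ 1#) (ℕₚ.+-comm b 1)
      (trans (Supp-corner (prodP-support b) (Supp-dilate (pow x b) t-support))
        (trans (*-cong (prodP-diagonal b) (*-identityˡ _)) (trans (*-identityˡ _) t-coefficient)))

    predual-unitriangular : Unitriangular (λ a b → predual x F (a , b))
    predual-unitriangular = record { supported = supported ; diagonal = diagonal }
      where
      supported : ∀ a b → Supp a b (predual x F (a , b))
      supported a b = ≡.subst (λ k → Supp k b (predual x F (a , b))) (ℕₚ.+-identityʳ a)
        (Supp-* (monomial-Supp (zpow-monomial a)) (prodP-support b))
      diagonal : ∀ a b → predual x F (a , b) a b ≈ 1#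
      diagonal a b = trans (monomial-*-shift (zpow-monomial a) (prodP x F b) a b ℕₚ.≤-refl z≤n)
        (trans (reflexive (≡.cong (λ k → prodP x F b k b) (ℕₚ.n∸n≡0 a))) (prodP-diagonal b))

  catalanP-startsWithT : ∀ Pt → StartsWithT (catalanP Pt)
  catalanP-startsWithT Pt = record { t-support = t-support ; t-coefficient = t-coefficient }
    where
    X-support : Supp 1 2 (zₛ *ₛ (Pt *ₛ (tₛ *ₛ tₛ)))
    X-support = Supp-* (monomial-Supp zₛ-monomial)
      (Supp-* {0} {0} (λ { _ _ (inj₁ ()) ; _ _ (inj₂ ()) }) (monomial-Supp (monomial-* tₛ-monomial tₛ-monomial)))
    t-support : Supp 0 1 (catalanP Pt)
    t-support i j (inj₂ j<1) = trans
      (+-cong (monomial-Supp tₛ-monomial i j (inj₂ j<1)) (-‿cong (X-support i j (inj₂ (ℕₚ.m≤n⇒m≤1+n j<1)))))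
      (trans (+-identityˡ _) -0≈0)
    t-coefficient : catalanP Pt 0 1 ≈ 1#
    t-coefficient = trans (+-congˡ (trans (-‿cong (X-support 0 1 (inj₁ (s≤s z≤n)))) -0≈0)) (+-identityʳ 1#)

  sumTuples-cong : ∀ n a b {F G : List (ℕ × ℕ) → Carrier} →
    (∀ ks → sumFst ks ≡ a → F ks ≈ G ks) → sumTuples n a b F ≈ sumTuples n a b G
  sumTuples-cong zero    zero    zero    F≈G = F≈G [] ≡.refl
  sumTuples-cong zero    zero    (suc b) F≈G = refl
  sumTuples-cong zero    (suc a) b       F≈G = refl
  sumTuples-cong (suc n) a       b       F≈G = Σ2-cong a b (λ a₁ b₁ a₁≤a _ →
    sumTuples-cong n (a ∸ a₁) (b ∸ b₁)
      (λ ks sum≡ → F≈G ((a₁ , b₁) ∷ ks) (≡.trans (≡.cong (a₁ ℕ.+_) sum≡) (ℕₚ.m+[n∸m]≡n a₁≤a))))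

  sumTuples-*ˡ : ∀ n a b x (F : List (ℕ × ℕ) → Carrier) →
    sumTuples n a b (λ ks → x * F ks) ≈ x * sumTuples n a b F
  sumTuples-*ˡ zero    zero    zero    x F = refl
  sumTuples-*ˡ zero    zero    (suc b) x F = sym (zeroʳ x)
  sumTuples-*ˡ zero    (suc a) b       x F = sym (zeroʳ x)
  sumTuples-*ˡ (suc n) a       b       x F = trans
    (Σ2-cong a b (λ a₁ b₁ _ _ → sumTuples-*ˡ n (a ∸ a₁) (b ∸ b₁) x _)) (sym (Σ2-*ˡ a b x _))

  prodT-cong : ∀ {T T′ : Coeffs} ks → (∀ x y → x ≤ sumFst ks → T (x , y) ≈ T′ (x , y)) →
    prodT T ks ≈ prodT T′ ks
  prodT-cong []             agree = refl
  prodT-cong ((x , y) ∷ ks) agree = *-cong (agree x y (ℕₚ.m≤m+n x _))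
    (prodT-cong ks (λ x′ y′ x′≤ → agree x′ y′ (ℕₚ.≤-trans x′≤ (ℕₚ.m≤n+m _ x))))

  module CatalanBasis (q : Carrier) (Pt : Series) where

    E : Family
    E a b = predual q (catalanP Pt) (a , b)

    E-unitriangular : Unitriangular E
    E-unitriangular = predual-unitriangular (catalanP-startsWithT Pt) q

    open Triangular E-unitriangular
    open Unitriangular E-unitriangular using (supported; diagonal)

    -- W T n (a,b) = Σ_{k_1+⋯+k_n=(a,b)} T_{k_1}⋯T_{k_n} q^{B(k_1,…,k_n)}; for dual
    -- coefficients T these are the coefficients of t^n.
    W : Coeffs → ℕ → Coeffs
    W T n (a , b) = sumTuples n a b (λ ks → prodT T ks * pow q (B ks))

    -- Peeling off k_1 = (a,b) turns W T (n+1) into a q-convolution.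
    W-suc : ∀ T n r → W T (suc n) r ≈ convolve q T (W T n) r
    W-suc T n (K₁ , K₂) = Σ2-cong K₁ K₂ (λ a b _ _ → trans
      (sumTuples-cong n (K₁ ∸ a) (K₂ ∸ b) (peel a b))
      (trans (sumTuples-*ˡ n (K₁ ∸ a) (K₂ ∸ b) _ _) (*-assoc _ _ _)))
      where
      peel : ∀ a b ks → sumFst ks ≡ K₁ ∸ a →
        T (a , b) * prodT T ks * pow q (b ℕ.* sumFst ks ℕ.+ B ks)
        ≈ T (a , b) * pow q (b ℕ.* (K₁ ∸ a)) * (prodT T ks * pow q (B ks))
      peel a b ks sum≡ = trans
        (*-congˡ (trans (pow-+ q (b ℕ.* sumFst ks) (B ks)) (*-congʳ (reflexive (≡.cong (λ u → pow q (b ℕ.* u)) sum≡)))))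
        (*-interchange _ _ _ _)

    W-cong : ∀ {T T′} n a b → (∀ x y → x ≤ a → T (x , y) ≈ T′ (x , y)) → W T n (a , b) ≈ W T′ n (a , b)
    W-cong n a b agree = sumTuples-cong n a b (λ ks sum≡ →
      *-congʳ (prodT-cong ks (λ x y x≤ → agree x y (≡.subst (x ≤_) sum≡ x≤))))

    W-zero : ∀ T a b → W T 0 (a , b) ≈ 1ₛ a b
    W-zero T zero    zero    = *-identityˡ 1#
    W-zero T zero    (suc b) = refl
    W-zero T (suc a) b       = refl

    convolve-zpow : ∀ c g r₁ r₂ → c ≤ r₁ → convolve q (uncurry (powₛ zₛ c)) g (r₁ , r₂) ≈ g (r₁ ∸ c , r₂)
    convolve-zpow c g r₁ r₂ c≤r₁ = trans
      (Σ2-single r₁ r₂ c 0 c≤r₁ z≤n (λ a b _ _ ne → trans (*-congʳ (elsewhere (zpow-monomial c) a b ne)) (zeroˡ _)))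
      (trans (*-congʳ (leading (zpow-monomial c))) (trans (*-identityˡ _) (*-identityˡ _)))

    convolve-zpow-below : ∀ c g r₁ r₂ → r₁ < c → convolve q (uncurry (powₛ zₛ c)) g (r₁ , r₂) ≈ 0#
    convolve-zpow-below c g r₁ r₂ r₁<c = Σ2-zero r₁ r₂ (λ a b a≤r₁ _ →
      trans (*-congʳ (elsewhere (zpow-monomial c) a b (inj₁ (ℕₚ.<⇒≢ (ℕₚ.≤-<-trans a≤r₁ r₁<c))))) (zeroˡ _))

    E₀₁≈P : E 0 1 ≈ₛ catalanP Pt
    E₀₁≈P = ≈ₛ-trans (*ₛ-identityˡ _) (≈ₛ-trans (*ₛ-identityˡ _)
      (≈ₛ-intro λ i j → trans (*-congʳ (pow-1 i)) (*-identityˡ _)))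

    δ₀₁≡tₛ : ∀ a b → δ₀₁ a b ≡ tₛ a b
    δ₀₁≡tₛ zero    zero          = ≡.refl
    δ₀₁≡tₛ zero    (suc zero)    = ≡.refl
    δ₀₁≡tₛ zero    (suc (suc b)) = ≡.refl
    δ₀₁≡tₛ (suc a) b             = ≡.refl

    expand-δ₀₁ : expand (uncurry δ₀₁) E ≈ₛ catalanP Pt
    expand-δ₀₁ = ≈ₛ-trans (expand-congᶜ E (λ r → reflexive (δ₀₁≡tₛ (proj₁ r) (proj₂ r))))
      (≈ₛ-trans (expand-monomial supported tₛ-monomial) E₀₁≈P)

    shifted-monomial-sum : ∀ F m n →
      Σ2 m (m ℕ.+ n) (λ i j → F i j * (powₛ zₛ (suc i) *ₛ powₛ tₛ (suc j)) m n) ≈ ((zₛ *ₛ tₛ) *ₛ F) m n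
    shifted-monomial-sum F zero n = trans
      (Σ2-zero 0 n {λ i j → F i j * (powₛ zₛ (suc i) *ₛ powₛ tₛ (suc j)) 0 n} (λ i j _ _ →
        trans (*-congˡ (elsewhere (zt-monomial (suc i) (suc j)) 0 n (inj₁ λ ()))) (zeroʳ _)))
      (sym (monomial-*-below zₛtₛ-monomial F 0 n (inj₁ (s≤s z≤n))))
    shifted-monomial-sum F (suc m) zero = trans
      (Σ2-zero (suc m) (suc m ℕ.+ 0) (λ i j _ _ →
        trans (*-congˡ (elsewhere (zt-monomial (suc i) (suc j)) (suc m) 0 (inj₂ λ ()))) (zeroʳ _)))
      (sym (monomial-*-below zₛtₛ-monomial F (suc m) 0 (inj₂ (s≤s z≤n))))
    shifted-monomial-sum F (suc m) (suc n) = begin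
      Σ2 (suc m) (suc m ℕ.+ suc n) (λ i j → F i j * (powₛ zₛ (suc i) *ₛ powₛ tₛ (suc j)) (suc m) (suc n))
        ≈⟨ Σ2-single (suc m) (suc m ℕ.+ suc n) m n (ℕₚ.n≤1+n m)
             (ℕₚ.≤-trans (ℕₚ.n≤1+n n) (ℕₚ.m≤n+m (suc n) (suc m))) off ⟩
      F m n * (powₛ zₛ (suc m) *ₛ powₛ tₛ (suc n)) (suc m) (suc n)
        ≈⟨ trans (*-congˡ (leading (zt-monomial (suc m) (suc n)))) (*-identityʳ _) ⟩
      F m n
        ≈⟨ sym (monomial-*-shift zₛtₛ-monomial F (suc m) (suc n) (s≤s z≤n) (s≤s z≤n)) ⟩
      ((zₛ *ₛ tₛ) *ₛ F) (suc m) (suc n) ∎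
      where
      open ≈-Reasoning
      off : ∀ i j → i ≤ suc m → j ≤ suc m ℕ.+ suc n → (i ≢ m ⊎ j ≢ n) →
        F i j * (powₛ zₛ (suc i) *ₛ powₛ tₛ (suc j)) (suc m) (suc n) ≈ 0#
      off i j _ _ ne = trans (*-congˡ (elsewhere (zt-monomial (suc i) (suc j)) (suc m) (suc n) (shift ne))) (zeroʳ _)
        where
        shift : (i ≢ m ⊎ j ≢ n) → (suc m ≢ suc i ⊎ suc n ≢ suc j)
        shift (inj₁ i≢m) = inj₁ (λ e → i≢m (≡.sym (ℕₚ.suc-injective e)))
        shift (inj₂ j≢n) = inj₂ (λ e → j≢n (≡.sym (ℕₚ.suc-injective e)))

    module Dual (T : Coeffs) (dual : expand T E ≈ₛ tₛ) where

      expand-W : ∀ n → expand (W T n) E ≈ₛ powₛ tₛ n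
      expand-W zero = ≈ₛ-trans (expand-congᶜ E (λ r → W-zero T (proj₁ r) (proj₂ r)))
        (≈ₛ-trans (expand-monomial supported 1ₛ-monomial) (*ₛ-identityˡ 1ₛ))
      expand-W (suc n) = begin
        expand (W T (suc n)) E
          ≈⟨ expand-congᶜ E (W-suc T n) ⟩
        expand (convolve q T (W T n)) E
          ≈⟨ expand-convolve q supported (predual-product q (catalanP Pt)) T (W T n) (powₛ tₛ n)
               (expand-W n) (λ b → dilate-invariant (pow q b) (tpow-monomial n)) ⟩
        expand T E *ₛ powₛ tₛ n
          ≈⟨ *ₛ-congʳ (powₛ tₛ n) dual ⟩
        powₛ tₛ (suc n) ∎
        where open ≈ₛ-Reasoning

      T₀₀≈0 : T (0 , 0) ≈ 0#
      T₀₀≈0 = trans (sym (*-identityʳ _)) (trans (*-congˡ (sym (diagonal 0 0))) (at dual 0 0))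

      -- As T_{(0,0)} = 0, n points of ℕ² summing to (a,b) contribute nothing when a + b < n.
      W-vanish : ∀ n a b → a ℕ.+ b < n → W T n (a , b) ≈ 0#
      W-vanish (suc n) a b deg<1+n = trans (W-suc T n (a , b)) (Σ2-zero a b term)
        where
        later-vanish : ∀ a₁ b₁ → (a ∸ a₁) ℕ.+ (b ∸ b₁) < a ℕ.+ b →
          T (a₁ , b₁) * (pow q (b₁ ℕ.* (a ∸ a₁)) * W T n (a ∸ a₁ , b ∸ b₁)) ≈ 0#
        later-vanish a₁ b₁ lt = trans (*-congˡ (trans (*-congˡ
          (W-vanish n _ _ (ℕₚ.<-≤-trans lt (ℕₚ.≤-pred deg<1+n)))) (zeroʳ _))) (zeroʳ _)
        term : ∀ a₁ b₁ → a₁ ≤ a → b₁ ≤ b →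
          T (a₁ , b₁) * (pow q (b₁ ℕ.* (a ∸ a₁)) * W T n (a ∸ a₁ , b ∸ b₁)) ≈ 0#
        term zero     zero     _    _    = trans (*-congʳ T₀₀≈0) (zeroˡ _)
        term (suc a₁) b₁       a₁<a _    = later-vanish (suc a₁) b₁
          (ℕₚ.+-mono-<-≤ (ℕₚ.∸-monoʳ-< (s≤s z≤n) a₁<a) (ℕₚ.m∸n≤m b b₁))
        term zero     (suc b₁) _    b₁<b = later-vanish zero (suc b₁)
          (ℕₚ.+-monoʳ-< a (ℕₚ.∸-monoʳ-< (s≤s z≤n) b₁<b))

      R : Series
      R = Pt *ₛ tₛ

      recursionSum : Coeffs
      recursionSum (r₁ , r₂) =
        sumBelow r₁ (λ i → sumTo (r₁ ℕ.+ r₂) (λ j → R i j * W T (suc j) (r₁ ∸ suc i , r₂)))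

      recursionRHS : Coeffs
      recursionRHS (r₁ , r₂) = δ₀₁ r₁ r₂ + recursionSum (r₁ , r₂)

      monomialCoeffs : ℕ → ℕ → Coeffs
      monomialCoeffs i j = convolve q (uncurry (powₛ zₛ (suc i))) (W T (suc j))

      expand-monomialCoeffs : ∀ i j → expand (monomialCoeffs i j) E ≈ₛ (powₛ zₛ (suc i) *ₛ powₛ tₛ (suc j))
      expand-monomialCoeffs i j = ≈ₛ-trans
        (expand-convolve q supported (predual-product q (catalanP Pt)) (uncurry (powₛ zₛ (suc i)))
          (W T (suc j)) (powₛ tₛ (suc j)) (expand-W (suc j)) (λ b → dilate-invariant (pow q b) (tpow-monomial (suc j))))
        (*ₛ-congʳ (powₛ tₛ (suc j))
          (≈ₛ-trans (expand-monomial supported (zpow-monomial (suc i))) (*ₛ-identityʳ (powₛ zₛ (suc i)))))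

      -- For (r₁,r₂) ≤ (m,n) the recursion sum can be taken over the box i ≤ m, j ≤ m + n:
      -- the added terms vanish, for i ≥ r₁ by the z-shift and for j > r₁ + r₂ by W-vanish.
      recursionSum-box : ∀ m n r₁ r₂ → r₁ ≤ m → r₂ ≤ n →
        recursionSum (r₁ , r₂) ≈ Σ2 m (m ℕ.+ n) (λ i j → R i j * monomialCoeffs i j (r₁ , r₂))
      recursionSum-box m n r₁ r₂ r₁≤m r₂≤n = sym (trans
        (sumTo-truncate r₁ m r₁≤m (λ i r₁≤i _ → sumTo-zero (m ℕ.+ n) (λ j _ →
          trans (*-congˡ (convolve-zpow-below (suc i) (W T (suc j)) r₁ r₂ (s≤s r₁≤i))) (zeroʳ _))))
        (sumBelow-cong r₁ (λ i i<r₁ → trans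
          (sumTo-cong (m ℕ.+ n) (λ j _ → *-congˡ (convolve-zpow (suc i) (W T (suc j)) r₁ r₂ i<r₁)))
          (sumTo-shorten (r₁ ℕ.+ r₂) (m ℕ.+ n) (ℕₚ.+-mono-≤ r₁≤m r₂≤n) (λ j deg<j _ →
            trans (*-congˡ (W-vanish (suc j) _ r₂ (ℕₚ.≤-<-trans (ℕₚ.+-monoˡ-≤ r₂ (ℕₚ.m∸n≤m r₁ (suc i)))
              (ℕₚ.<-trans deg<j (ℕₚ.n<1+n j))))) (zeroʳ _))))))

      X≈ztR : zₛ *ₛ (Pt *ₛ (tₛ *ₛ tₛ)) ≈ₛ (zₛ *ₛ tₛ) *ₛ R
      X≈ztR = ≈ₛ-trans (*ₛ-congˡ zₛ (≈ₛ-trans (≈ₛ-sym (*ₛ-assoc Pt tₛ tₛ)) (*ₛ-comm R tₛ)))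
        (≈ₛ-sym (*ₛ-assoc zₛ tₛ R))

      expand-recursionSum : ∀ m n → expand recursionSum E m n ≈ (zₛ *ₛ (Pt *ₛ (tₛ *ₛ tₛ))) m n
      expand-recursionSum m n = begin
        Σ2 m n (λ a b → recursionSum (a , b) * E a b m n)
          ≈⟨ Σ2-cong m n (λ a b a≤m b≤n → *-congʳ (recursionSum-box m n a b a≤m b≤n)) ⟩
        Σ2 m n (λ a b → Σ2 m J (λ i j → R i j * monomialCoeffs i j (a , b)) * E a b m n)
          ≈⟨ Σ2-cong m n (λ a b _ _ → Σ2-*ʳ m J _ _) ⟩
        Σ2 m n (λ a b → Σ2 m J (λ i j → R i j * monomialCoeffs i j (a , b) * E a b m n))
          ≈⟨ Σ2-swap m n m J _ ⟩
        Σ2 m J (λ i j → Σ2 m n (λ a b → R i j * monomialCoeffs i j (a , b) * E a b m n))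
          ≈⟨ Σ2-cong m J (λ i j _ _ →
               trans (Σ2-cong m n (λ a b _ _ → *-assoc _ _ _)) (sym (Σ2-*ˡ m n (R i j) _))) ⟩
        Σ2 m J (λ i j → R i j * expand (monomialCoeffs i j) E m n)
          ≈⟨ Σ2-cong m J (λ i j _ _ → *-congˡ (at (expand-monomialCoeffs i j) m n)) ⟩
        Σ2 m J (λ i j → R i j * (powₛ zₛ (suc i) *ₛ powₛ tₛ (suc j)) m n)
          ≈⟨ shifted-monomial-sum R m n ⟩
        ((zₛ *ₛ tₛ) *ₛ R) m n
          ≈⟨ sym (at X≈ztR m n) ⟩
        (zₛ *ₛ (Pt *ₛ (tₛ *ₛ tₛ))) m n ∎
        where
        open ≈-Reasoning
        J : ℕ
        J = m ℕ.+ n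

      -- The right-hand side of the recursion expands P + z P~ t² = t.
      expand-recursionRHS : expand recursionRHS E ≈ₛ tₛ
      expand-recursionRHS = ≈ₛ-intro λ m n → begin
        expand recursionRHS E m n
          ≈⟨ expand-+ (uncurry δ₀₁) recursionSum E m n ⟩
        expand (uncurry δ₀₁) E m n + expand recursionSum E m n
          ≈⟨ +-cong (at expand-δ₀₁ m n) (expand-recursionSum m n) ⟩
        catalanP Pt m n + (zₛ *ₛ (Pt *ₛ (tₛ *ₛ tₛ))) m n
          ≈⟨ //-rightDividesˡ _ _ ⟩
        tₛ m n ∎
        where open ≈-Reasoning

      -- Both T and the right-hand side are dual coefficients, so they agree.
      satisfies-recursion : SatisfiesRec q Pt T
      satisfies-recursion r₁ r₂ =
        expand-injective T recursionRHS (≈ₛ-trans dual (≈ₛ-sym expand-recursionRHS)) (r₁ , r₂)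

    dual-exists : Σ Coeffs (IsDual q (catalanP Pt))
    dual-exists = solution tₛ , at (expand-solution tₛ)

    dual⇒recursion : ∀ T → IsDual q (catalanP Pt) T → SatisfiesRec q Pt T
    dual⇒recursion T dual = Dual.satisfies-recursion T (≈ₛ-intro dual)

    -- The recursion determines T_{(r₁,·)} from the T_{(a,·)} with a < r₁.
    recursion-unique : ∀ T T′ → SatisfiesRec q Pt T → SatisfiesRec q Pt T′ → ∀ r → T r ≈ T′ r
    recursion-unique T T′ rec rec′ (r₁ , r₂) = <-rec Agree step r₁ r₂
      where
      Agree : ℕ → Set ℓ
      Agree r₁ = ∀ r₂ → T (r₁ , r₂) ≈ T′ (r₁ , r₂)
      step : ∀ r₁ → (∀ {a} → a < r₁ → Agree a) → Agree r₁
      step r₁ earlier r₂ = trans (rec r₁ r₂) (trans (+-congˡ (sumBelow-cong r₁ (λ i i<r₁ →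
        sumTo-cong (r₁ ℕ.+ r₂) (λ j _ → *-congˡ (W-cong (suc j) (r₁ ∸ suc i) r₂ (λ x y x≤ →
          earlier (ℕₚ.≤-<-trans x≤ (ℕₚ.∸-monoʳ-< (s≤s z≤n) i<r₁)) y))))))
        (sym (rec′ r₁ r₂)))

theorem3p3 : ∀ {c ℓ} (CR : CommutativeRing c ℓ) →
  let open CommutativeRing CR
      open Defs.Catalan CR
  in (q : Carrier) (Pt : Series) →
     Σ (ℕ × ℕ → Carrier) (λ T → IsDual q (catalanP Pt) T)
     × (∀ T → IsDual q (catalanP Pt) T → SatisfiesRec q Pt T)
     × (∀ T T′ → SatisfiesRec q Pt T → SatisfiesRec q Pt T′ → ∀ r → T r ≈ T′ r)
theorem3p3 CR q Pt = dual-exists , dual⇒recursion , recursion-unique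
  where open Duality.CatalanBasis CR q Pt
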